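{- Let $f:\mathbb{Z}_{>0}\to\mathbb{C}$ be an arithmetical function and let $g(n)=\sum_{d\mid n} f(d)$ for $n\ge 1$. Then for every integer $n\ge 1$, \[ \sum_{k=1}^{n} g(k)\,\omega(n-k)=\sum_{\substack{m+k=n\\ m\ge 1,\ k\ge 0}} f(m)\Big(\omega(k)+\omega(k-m)+\omega(k-2m)+\cdots\Big), \] where the inner sum is $\sum_{j\ge 0}\omega(k-jm)$ (a finite sum).
   Context: For integers $m$, define $\omega(m)=1$ if $m=0$; $\omega(m)=(-1)^k$ if $m=\frac{3k^2\pm k}{2}$ for some positive integer $k$; $\omega(m)=0$ otherwise (in particular $\omega(m)=0$ for $m<0$). Thus $\prod_{n\ge1}(1-q^n)=\sum_{m\ge0}\omega(m)q^m$ for $|q|<1$. -}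

module Defs where

open import Level using (Level)
open import Data.Nat as ℕ using (ℕ; zero; suc; _∸_; _≟_)
open import Data.Nat.Divisibility using (_∣?_)
open import Data.Integer as ℤ using (ℤ; +_; -[1+_])
open import Data.Bool using (Bool; true; false; if_then_else_; _∨_)
open import Relation.Nullary.Decidable using (does)
open import Algebra.Bundles using (CommutativeRing)

sgn : ℕ → ℤ
sgn zero    = + 1
sgn (suc k) = ℤ.- sgn k

-- does m (≥ 1) equal (3k² + k)/2 or (3k² - k)/2 ?  (checked as 2m = 3k² ± k)
isPent : ℕ → ℕ → Bool
isPent k m = does (2 ℕ.* m ≟ 3 ℕ.* k ℕ.* k ℕ.+ k)
           ∨ does (2 ℕ.* m ℕ.+ k ≟ 3 ℕ.* k ℕ.* k)

search : ℕ → ℕ → ℤ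
search zero    m = + 0
search (suc k) m = if isPent (suc k) m then sgn (suc k) else search k m

-- For m ≥ 1 any k with (3k²±k)/2 = m
-- satisfies k ≤ m, so searching k ∈ {1,…,m} is exhaustive; the generalized
-- pentagonal numbers are pairwise distinct, so the value is well defined.
ω : ℤ → ℤ
ω (+ zero)    = + 1
ω (+ suc m)   = search (suc m) (suc m)
ω -[1+ _ ]    = + 0

module WithRing {c ℓ : Level} (R : CommutativeRing c ℓ) where
  open CommutativeRing R

  natR : ℕ → Carrier
  natR zero    = 0#
  natR (suc n) = 1# + natR n

  ι : ℤ → Carrier
  ι (+ n)      = natR n
  ι -[1+ n ]   = - natR (suc n)

  ∑ : ℕ → (ℕ → Carrier) → Carrier
  ∑ zero    h = 0#
  ∑ (suc n) h = ∑ n h + h n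

  divSum : (ℕ → Carrier) → ℕ → Carrier
  divSum f n = ∑ n (λ i → if does (suc i ∣? n) then f (suc i) else 0#)

{-# OPTIONS --safe #-}
-- Writing W k = ω (n - k), the left side is ∑_k ∑_{d ∣ k} f d · W k; exchanging the
-- sums gives ∑_d f d · ∑_{j ≥ 1} W (j d).  Since W vanishes beyond n, every range may be
-- cut off or extended freely, and W ((j + 1) d) = ω ((n - d) - j d) gives the inner sum
-- on the right.
module Submission where

open import Defs
open import Algebra.Bundles using (CommutativeRing)
open import Data.Bool using (true; false; if_then_else_)
open import Data.Integer as ℤ using (ℤ; +_; -[1+_]; _⊖_)
import Data.Integer.Properties as ℤ
open import Data.Nat as ℕ using (ℕ; zero; suc; _∸_; _≥_; _<_; _≤_; z<s; s≤s; NonZero)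
import Data.Nat.Properties as ℕ
open import Data.Nat.Divisibility using (_∣_; _∣?_; ∣m+n∣m⇒∣n; ∣⇒≤; n∣m*n)
open import Function using (_∘_)
open import Level using (Level)
open import Relation.Nullary using (¬_)
open import Relation.Nullary.Decidable using (does; dec-true; dec-false)
open import Relation.Binary.PropositionalEquality as ≡ using (_≡_)

m⊖n≡-[1+n∸[1+m]] : ∀ {m n} → m < n → m ⊖ n ≡ -[1+ n ∸ suc m ]
m⊖n≡-[1+n∸[1+m]] {zero}  {suc n} _         = ≡.refl
m⊖n≡-[1+n∸[1+m]] {suc m} {suc n} (s≤s m<n) =
  ≡.trans (ℤ.[1+m]⊖[1+n]≡m⊖n m n) (m⊖n≡-[1+n∸[1+m]] m<n)

[m∸n]⊖o≡m⊖[n+o] : ∀ {m n} o → n ≤ m → (m ∸ n) ⊖ o ≡ m ⊖ (n ℕ.+ o)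
[m∸n]⊖o≡m⊖[n+o]         {n = zero}  o _         = ≡.refl
[m∸n]⊖o≡m⊖[n+o] {suc m} {suc n}     o (s≤s n≤m) =
  ≡.trans ([m∸n]⊖o≡m⊖[n+o] o n≤m) (≡.sym (ℤ.[1+m]⊖[1+n]≡m⊖n m (n ℕ.+ o)))

+m-+n≡-[1+n∸[1+m]] : ∀ {m n} → m < n → + m ℤ.- + n ≡ -[1+ n ∸ suc m ]
+m-+n≡-[1+n∸[1+m]] {m} {n} m<n = ≡.trans (ℤ.m-n≡m⊖n m n) (m⊖n≡-[1+n∸[1+m]] m<n)

+[m∸n]-+o≡+m-+[n+o] : ∀ {m n} o → n ≤ m → + (m ∸ n) ℤ.- + o ≡ + m ℤ.- + (n ℕ.+ o)
+[m∸n]-+o≡+m-+[n+o] {m} {n} o n≤m = begin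
  + (m ∸ n) ℤ.- + o   ≡⟨ ℤ.m-n≡m⊖n (m ∸ n) o ⟩
  (m ∸ n) ⊖ o         ≡⟨ [m∸n]⊖o≡m⊖[n+o] o n≤m ⟩
  m ⊖ (n ℕ.+ o)       ≡⟨ ℤ.m-n≡m⊖n m (n ℕ.+ o) ⟨
  + m ℤ.- + (n ℕ.+ o) ∎
  where open ≡.≡-Reasoning

n∸m<b⇒n<[1+b]*m : ∀ {m n b} .{{_ : NonZero m}} → m ≤ n → n ∸ m < b → n < suc b ℕ.* m
n∸m<b⇒n<[1+b]*m {m} {n} {b} m≤n n∸m<b = begin-strict
  n               ≡⟨ ℕ.m+[n∸m]≡n m≤n ⟨
  m ℕ.+ (n ∸ m)   <⟨ ℕ.+-monoʳ-< m n∸m<b ⟩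
  m ℕ.+ b         ≤⟨ ℕ.+-monoʳ-≤ m (ℕ.m≤m*n b m) ⟩
  suc b ℕ.* m     ∎
  where open ℕ.≤-Reasoning

m∤q*m+[1+r] : ∀ {m q r} → suc r < m → ¬ m ∣ q ℕ.* m ℕ.+ suc r
m∤q*m+[1+r] {q = q} 1+r<m m∣q*m+1+r = ℕ.<⇒≱ 1+r<m (∣⇒≤ (∣m+n∣m⇒∣n m∣q*m+1+r (n∣m*n q)))

module Sums {c ℓ : Level} (R : CommutativeRing c ℓ) where
  open CommutativeRing R
  open WithRing R
  open import Relation.Binary.Reasoning.Setoid setoid
  open import Algebra.Properties.CommutativeSemigroup +-commutativeSemigroup using (interchange)

  ∑-cong : ∀ n {h h′ : ℕ → Carrier} → (∀ i → i < n → h i ≈ h′ i) → ∑ n h ≈ ∑ n h′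
  ∑-cong zero    h≈h′ = refl
  ∑-cong (suc n) h≈h′ = +-cong (∑-cong n (λ i i<n → h≈h′ i (ℕ.m<n⇒m<1+n i<n))) (h≈h′ n ℕ.≤-refl)

  ∑-zero : ∀ n {h : ℕ → Carrier} → (∀ i → i < n → h i ≈ 0#) → ∑ n h ≈ 0#
  ∑-zero n h≈0 = trans (∑-cong n h≈0) (∑-0# n)
    where
    ∑-0# : ∀ n → ∑ n (λ _ → 0#) ≈ 0#
    ∑-0# zero    = refl
    ∑-0# (suc n) = trans (+-identityʳ _) (∑-0# n)

  ∑-distrib-+ : ∀ n (h k : ℕ → Carrier) → ∑ n (λ i → h i + k i) ≈ ∑ n h + ∑ n k
  ∑-distrib-+ zero    h k = sym (+-identityʳ 0#)
  ∑-distrib-+ (suc n) h k = trans (+-cong (∑-distrib-+ n h k) refl) (interchange _ _ _ _)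

  *-distribˡ-∑ : ∀ n a (h : ℕ → Carrier) → a * ∑ n h ≈ ∑ n (λ i → a * h i)
  *-distribˡ-∑ zero    a h = zeroʳ a
  *-distribˡ-∑ (suc n) a h = trans (distribˡ a _ _) (+-cong (*-distribˡ-∑ n a h) refl)

  *-distribʳ-∑ : ∀ n a (h : ℕ → Carrier) → ∑ n h * a ≈ ∑ n (λ i → h i * a)
  *-distribʳ-∑ n a h =
    trans (*-comm _ a) (trans (*-distribˡ-∑ n a h) (∑-cong n (λ i _ → *-comm a (h i))))

  ∑-comm : ∀ n m (h : ℕ → ℕ → Carrier) → ∑ n (λ i → ∑ m (h i)) ≈ ∑ m (λ j → ∑ n (λ i → h i j))
  ∑-comm zero    m h = sym (∑-zero m (λ _ _ → refl))
  ∑-comm (suc n) m h = trans (+-cong (∑-comm n m h) refl) (sym (∑-distrib-+ m _ _))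

  ∑-split : ∀ a b (h : ℕ → Carrier) → ∑ (a ℕ.+ b) h ≈ ∑ a h + ∑ b (λ i → h (a ℕ.+ i))
  ∑-split a zero    h rewrite ℕ.+-identityʳ a = sym (+-identityʳ _)
  ∑-split a (suc b) h rewrite ℕ.+-suc a b = trans (+-cong (∑-split a b h) refl) (+-assoc _ _ _)

  ∑-extend : ∀ {n N} {h : ℕ → Carrier} → n ≤ N → (∀ i → n ≤ i → h i ≈ 0#) → ∑ N h ≈ ∑ n h
  ∑-extend {n} {N} {h} n≤N tail≈0 = begin
    ∑ N h                                      ≡⟨ ≡.cong (λ M → ∑ M h) (ℕ.m+[n∸m]≡n n≤N) ⟨
    ∑ (n ℕ.+ (N ∸ n)) h                        ≈⟨ ∑-split n (N ∸ n) h ⟩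
    ∑ n h + ∑ (N ∸ n) (λ i → h (n ℕ.+ i))      ≈⟨ +-congˡ (∑-zero (N ∸ n) (λ i _ → tail≈0 (n ℕ.+ i) (ℕ.m≤m+n n i))) ⟩
    ∑ n h + 0#                                 ≈⟨ +-identityʳ _ ⟩
    ∑ n h                                      ∎

  infix 8 [_∣_]_
  [_∣_]_ : ℕ → ℕ → Carrier → Carrier
  [ m ∣ k ] x = if does (m ∣? k) then x else 0#

  [∣]-true : ∀ {m k} x → m ∣ k → [ m ∣ k ] x ≡ x
  [∣]-true {m} {k} x m∣k rewrite dec-true (m ∣? k) m∣k = ≡.refl

  [∣]-false : ∀ {m k} x → ¬ m ∣ k → [ m ∣ k ] x ≡ 0#
  [∣]-false {m} {k} x m∤k rewrite dec-false (m ∣? k) m∤k = ≡.refl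

  [∣]-≈0 : ∀ m k {x} → x ≈ 0# → [ m ∣ k ] x ≈ 0#
  [∣]-≈0 m k x≈0 with does (m ∣? k)
  ... | true  = x≈0
  ... | false = refl

  [∣]-*-comm : ∀ m k x y → ([ m ∣ k ] x) * y ≈ x * [ m ∣ k ] y
  [∣]-*-comm m k x y with does (m ∣? k)
  ... | true  = refl
  ... | false = trans (zeroˡ y) (sym (zeroʳ x))

  divSum-extend : ∀ f {k n} → suc k ≤ n → divSum f (suc k) ≈ ∑ n (λ d → [ suc d ∣ suc k ] f (suc d))
  divSum-extend f 1+k≤n = sym (∑-extend 1+k≤n (λ d k<d →
    reflexive ([∣]-false _ (λ d∣k → ℕ.<⇒≱ (s≤s k<d) (∣⇒≤ d∣k)))))

  -- In the block of length m ending at (q + 1) m only the last index is a multiple of m.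
  ∑-multiples-blocks : ∀ d (G : ℕ → Carrier) q →
    ∑ (q ℕ.* suc d) (λ i → [ suc d ∣ suc i ] G (suc i)) ≈ ∑ q (λ b → G (suc b ℕ.* suc d))
  ∑-multiples-blocks d G zero    = refl
  ∑-multiples-blocks d G (suc q) = begin
    ∑ (m ℕ.+ q ℕ.* m) h                           ≡⟨ ≡.cong (λ M → ∑ M h) (ℕ.+-comm m (q ℕ.* m)) ⟩
    ∑ (q ℕ.* m ℕ.+ m) h                           ≈⟨ ∑-split (q ℕ.* m) m h ⟩
    ∑ (q ℕ.* m) h + ∑ m (λ r → h (q ℕ.* m ℕ.+ r)) ≈⟨ +-cong (∑-multiples-blocks d G q) block ⟩
    ∑ q (λ b → G (suc b ℕ.* m)) + G (suc q ℕ.* m) ∎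
    where
    m : ℕ
    m = suc d
    h : ℕ → Carrier
    h i = [ m ∣ suc i ] G (suc i)

    last≡ : suc (q ℕ.* m ℕ.+ d) ≡ suc q ℕ.* m
    last≡ = ≡.trans (≡.sym (ℕ.+-suc (q ℕ.* m) d)) (ℕ.+-comm (q ℕ.* m) m)

    inner≈0 : ∀ r → r < d → h (q ℕ.* m ℕ.+ r) ≈ 0#
    inner≈0 r r<d = reflexive ([∣]-false _
      (m∤q*m+[1+r] {q = q} (s≤s r<d) ∘ ≡.subst (m ∣_) (≡.sym (ℕ.+-suc (q ℕ.* m) r))))

    block : ∑ m (λ r → h (q ℕ.* m ℕ.+ r)) ≈ G (suc q ℕ.* m)
    block = begin
      ∑ d (λ r → h (q ℕ.* m ℕ.+ r)) + h (q ℕ.* m ℕ.+ d) ≈⟨ +-congʳ (∑-zero d inner≈0) ⟩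
      0# + h (q ℕ.* m ℕ.+ d)                          ≈⟨ +-identityˡ _ ⟩
      h (q ℕ.* m ℕ.+ d)                               ≡⟨ ≡.cong h′ last≡ ⟩
      h′ (suc q ℕ.* m)                                ≡⟨ [∣]-true {m} _ (n∣m*n (suc q)) ⟩
      G (suc q ℕ.* m)                                 ∎
      where
      h′ : ℕ → Carrier
      h′ k = [ m ∣ k ] G k

  ∑-multiples : ∀ d n (F : ℕ → Carrier) → (∀ k → n < k → F k ≈ 0#) →
    ∑ n (λ i → [ suc d ∣ suc i ] F (suc i)) ≈ ∑ n (λ b → F (suc b ℕ.* suc d))
  ∑-multiples d n F F≈0 = trans
    (sym (∑-extend (ℕ.m≤m*n n (suc d)) (λ i n≤i → [∣]-≈0 (suc d) (suc i) (F≈0 (suc i) (s≤s n≤i)))))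
    (∑-multiples-blocks d F n)

  ∑-divSum-* : ∀ f F n → (∀ k → n < k → F k ≈ 0#) →
    ∑ n (λ i → divSum f (suc i) * F (suc i)) ≈ ∑ n (λ d → f (suc d) * ∑ n (λ b → F (suc b ℕ.* suc d)))
  ∑-divSum-* f F n F≈0 = begin
    ∑ n (λ i → divSum f (suc i) * F (suc i))
      ≈⟨ ∑-cong n (λ i i<n → *-congʳ (divSum-extend f i<n)) ⟩
    ∑ n (λ i → ∑ n (λ d → [ suc d ∣ suc i ] f (suc d)) * F (suc i))
      ≈⟨ ∑-cong n (λ i _ → *-distribʳ-∑ n (F (suc i)) _) ⟩
    ∑ n (λ i → ∑ n (λ d → [ suc d ∣ suc i ] f (suc d) * F (suc i)))
      ≈⟨ ∑-comm n n _ ⟩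
    ∑ n (λ d → ∑ n (λ i → [ suc d ∣ suc i ] f (suc d) * F (suc i)))
      ≈⟨ ∑-cong n (λ d _ → ∑-cong n (λ i _ → [∣]-*-comm (suc d) (suc i) (f (suc d)) (F (suc i)))) ⟩
    ∑ n (λ d → ∑ n (λ i → f (suc d) * [ suc d ∣ suc i ] F (suc i)))
      ≈⟨ ∑-cong n (λ d _ → sym (*-distribˡ-∑ n (f (suc d)) _)) ⟩
    ∑ n (λ d → f (suc d) * ∑ n (λ i → [ suc d ∣ suc i ] F (suc i)))
      ≈⟨ ∑-cong n (λ d _ → *-congˡ (∑-multiples d n F F≈0)) ⟩
    ∑ n (λ d → f (suc d) * ∑ n (λ b → F (suc b ℕ.* suc d)))
      ∎

  module _ (φ : ℤ → Carrier) (φ-negative : ∀ k → φ -[1+ k ] ≈ 0#) where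

    φ[m-n]≈0 : ∀ {m n} → m < n → φ (+ m ℤ.- + n) ≈ 0#
    φ[m-n]≈0 m<n = trans (reflexive (≡.cong φ (+m-+n≡-[1+n∸[1+m]] m<n))) (φ-negative _)

    ∑-φ-multiples : ∀ {d n} → suc d ≤ n →
      ∑ (suc (n ∸ suc d)) (λ j → φ (+ (n ∸ suc d) ℤ.- + (j ℕ.* suc d)))
        ≈ ∑ n (λ b → φ (+ n ℤ.- + (suc b ℕ.* suc d)))
    ∑-φ-multiples {d} {n} m≤n = begin
      ∑ (suc (n ∸ m)) (λ j → φ (+ (n ∸ m) ℤ.- + (j ℕ.* m)))
        ≈⟨ ∑-cong (suc (n ∸ m)) (λ j _ → reflexive (≡.cong φ (+[m∸n]-+o≡+m-+[n+o] (j ℕ.* m) m≤n))) ⟩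
      ∑ (suc (n ∸ m)) (λ b → φ (+ n ℤ.- + (suc b ℕ.* m)))
        ≈⟨ ∑-extend (ℕ.∸-monoʳ-< z<s m≤n) (λ b n∸m<b → φ[m-n]≈0 (n∸m<b⇒n<[1+b]*m m≤n n∸m<b)) ⟨
      ∑ n (λ b → φ (+ n ℤ.- + (suc b ℕ.* m)))
        ∎
      where
      m : ℕ
      m = suc d

theorem1 : ∀ {c ℓ} (R : CommutativeRing c ℓ) (f : ℕ → CommutativeRing.Carrier R) (n : ℕ) → n ≥ 1 →
    let open CommutativeRing R
        open WithRing R
    in ∑ n (λ i → divSum f (suc i) * ι (ω (+ n ℤ.- + suc i)))
       ≈ ∑ n (λ i → f (suc i) * ∑ (suc (n ∸ suc i)) (λ j → ι (ω (+ (n ∸ suc i) ℤ.- + (j ℕ.* suc i)))))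
theorem1 R f n _ = begin
  ∑ n (λ i → divSum f (suc i) * W (suc i))
    ≈⟨ ∑-divSum-* f W n (λ k → φ[m-n]≈0 (ι ∘ ω) (λ _ → refl)) ⟩
  ∑ n (λ d → f (suc d) * ∑ n (λ b → W (suc b ℕ.* suc d)))
    ≈⟨ ∑-cong n (λ d d<n → *-congˡ (∑-φ-multiples (ι ∘ ω) (λ _ → refl) d<n)) ⟨
  ∑ n (λ d → f (suc d) * ∑ (suc (n ∸ suc d)) (λ j → ι (ω (+ (n ∸ suc d) ℤ.- + (j ℕ.* suc d)))))
    ∎
  where
  open CommutativeRing R
  open WithRing R
  open Sums R
  open import Relation.Binary.Reasoning.Setoid setoid

  W : ℕ → Carrier
  W k = ι (ω (+ n ℤ.- + k))
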